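{- Let $(M,w)$ and $(M',w')$ be pointed models that are collectively $\mathtt{P}$-bisimilar. Then for every $\psi\in\mathcal{L}^*$, $(M,w)\Vdash\psi$ if and only if $(M',w')\Vdash\psi$.
   Context: Fix a finite non-empty set of agents $A$ and a non-empty countable set of atoms $\mathtt{P}$. A model is $M=\langle W,R,V\rangle$ with $W$ non-empty, $R=\{R_i\subseteq W\times W\mid i\in A\}$ arbitrary relations, $V:\mathtt{P}\to\mathcal{P}(W)$; $R_G:=\bigcap_{k\in G}R_k$ (with $R_\emptyset:=W\times W$). $\mathcal{L}_D$: $\varphi::=p\mid\lnot\varphi\mid\varphi\land\varphi\mid D_G\varphi$ ($\emptyset\neq G\subseteq A$), with $(M,w)\Vdash D_G\varphi$ iff $\varphi$ holds at all $u$ with $(w,u)\in R_G$. $\|\chi\|^M$ is the truth set of $\chi$, $\sim^M_\chi:=(\|\chi\|^M\times\|\chi\|^M)\cup(\|\lnot\chi\|^M\times\|\lnot\chi\|^M)$, and for $S\subseteq A$, $M^{S,\chi}=\langle W,R^{S,\chi},V\rangle$ with $R^{S,\chi}_i:=R_i\cap(R_S\cup\sim^M_\chi)$. The language $\mathcal{L}^*$ is $\bigcup_n\mathcal{L}^{*,n}$, where $\mathcal{L}^{*,0}$ is $\mathcal{L}_D$ extended with formulas $[S]\varphi$ ($S\subseteq A$), and $\mathcal{L}^{*,n+1}$ extends $\mathcal{L}^{*,n}$ with formulas $[S,\chi]\varphi$ for $S\subseteq A$, $\chi\in\mathcal{L}^{*,n}$. Semantics: $(M,w)\Vdash[S,\chi]\varphi$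 iff $(M^{S,\chi},w)\Vdash\varphi$; $(M,w)\Vdash[S]\varphi$ iff $(M^{S,\chi},w)\Vdash\varphi$ for every $\chi\in\mathcal{L}_D$. A collective $\mathtt{P}$-bisimulation between $M$ and $M'=\langle W',R',V'\rangle$ is a non-empty $Z\subseteq W\times W'$ such that each $(u,u')\in Z$ satisfies: same atoms; for every $G\subseteq A$ and $(u,v)\in R_G$ some $v'$ has $(u',v')\in R'_G$, $(v,v')\in Z$; and symmetrically (back). $(M,w),(M',w')$ are collectively $\mathtt{P}$-bisimilar if such $Z$ contains $(w,w')$. -}

module Defs where

open import Data.Nat using (ℕ; suc; _<_)
open import Data.Fin using (Fin)
open import Data.Fin.Subset using (Subset; _∈_; Nonempty)
open import Data.Product using (Σ; _×_; _,_; ∃)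
open import Data.Sum using (_⊎_)
open import Relation.Nullary using (¬_)
open import Function.Bundles using (_⇔_)

-- Agents: A = Fin (suc k) (finite, non-empty).  Atoms: an arbitrary type P
-- (the countability / non-emptiness assumptions are taken as hypotheses
-- in the statement).
module Logic (k : ℕ) (P : Set) where

  Agent : Set
  Agent = Fin (suc k)

  Group : Set
  Group = Subset (suc k)

  record Model : Set₁ where
    field
      W     : Set
      point : W                       -- W is non-empty
      R     : Agent → W → W → Set
      V     : P → W → Set
  open Model public

  -- R_G := ⋂_{i ∈ G} R_i  (R_∅ is the full relation)
  RG : (M : Model) → Group → W M → W M → Set
  RG M G u v = ∀ i → i ∈ G → R M i u v

  -- ∼_X for a truth set X (its complement being the truth set of ¬χ)
  Sim : {W : Set} → (W → Set) → W → W → Set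
  Sim X u v = (X u × X v) ⊎ (¬ X u × ¬ X v)

  -- M^{S,χ}, given the truth set X = ‖χ‖^M
  upd : (M : Model) → Group → (W M → Set) → Model
  upd M S X = record
    { W = W M ; point = point M ; V = V M
    ; R = λ i u v → R M i u v × (RG M S u v ⊎ Sim X u v) }

  data FormD : Set where
    atom : P → FormD
    neg  : FormD → FormD
    and  : FormD → FormD → FormD
    D    : (G : Group) → Nonempty G → FormD → FormD

  satD : (M : Model) → W M → FormD → Set
  satD M w (atom p)  = V M p w
  satD M w (neg φ)   = ¬ satD M w φ
  satD M w (and φ ψ) = satD M w φ × satD M w ψ
  satD M w (D G _ φ) = ∀ u → RG M G w u → satD M u φ

  -- L^{*,n}: formulas whose announced χ in [S,χ] come from L^{*,m}, m < n.
  data Form : ℕ → Set where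
    atom : ∀ {n} → P → Form n
    neg  : ∀ {n} → Form n → Form n
    and  : ∀ {n} → Form n → Form n → Form n
    D    : ∀ {n} → (G : Group) → Nonempty G → Form n → Form n
    all  : ∀ {n} → Group → Form n → Form n
    ann  : ∀ {m n} → m < n → Group → Form m → Form n → Form n

  LStar : Set
  LStar = Σ ℕ Form

  sat : ∀ {n} (M : Model) → W M → Form n → Set
  sat M w (atom p)      = V M p w
  sat M w (neg φ)       = ¬ sat M w φ
  sat M w (and φ ψ)     = sat M w φ × sat M w ψ
  sat M w (D G _ φ)     = ∀ u → RG M G w u → sat M u φ
  sat M w (all S φ)     = ∀ (χ : FormD) → sat (upd M S (λ u → satD M u χ)) w φ
  sat M w (ann _ S χ φ) = sat (upd M S (λ u → sat M u χ)) w φ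

  _⊩_ : (Σ Model W) → LStar → Set
  (M , w) ⊩ (_ , ψ) = sat M w ψ

  record IsBisim (M M' : Model) (Z : W M → W M' → Set) : Set where
    field
      nonempty : Σ (W M) λ u → Σ (W M') λ u' → Z u u'
      atoms : ∀ {u u'} → Z u u' → ∀ p → (V M p u ⇔ V M' p u')
      forth : ∀ {u u'} → Z u u' → ∀ (G : Group) v → RG M G u v →
              Σ (W M') λ v' → RG M' G u' v' × Z v v'
      back  : ∀ {u u'} → Z u u' → ∀ (G : Group) v' → RG M' G u' v' →
              Σ (W M) λ v → RG M G u v × Z v v'

  CollBisimilar : (Σ Model W) → (Σ Model W) → Set₁
  CollBisimilar (M , w) (M' , w') =
    Σ (W M → W M' → Set) λ Z → IsBisim M M' Z × Z w w'

{-# OPTIONS --safe #-}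
module Submission where

-- Induction on the formula; the D_G clause is exactly the forth/back condition for R_G.
-- For announcements the point is that Z stays a collective bisimulation between the
-- updated models M^{S,χ} and M'^{S,χ} whenever Z-related worlds agree on χ, which the
-- induction hypothesis (for [S], invariance of L_D) provides. An updated R_G-edge is
-- either an R_{G∪S}-edge or an R_G-edge inside a ∼_χ-class, and both kinds are matched
-- by the old forth condition.

open import Defs
open import Data.Nat using (ℕ)
open import Data.Product using (Σ; _×_; _,_; proj₁; proj₂)
open import Data.Product.Function.NonDependent.Propositional using (_×-⇔_)
open import Data.Sum using (_⊎_; inj₁; inj₂)
open import Data.Empty using (⊥-elim)
open import Relation.Nullary using (yes; no)
open import Data.Fin.Subset using (_∪_; _⊆_; Nonempty)
open import Data.Fin.Subset.Properties using (nonempty?; p⊆p∪q; q⊆p∪q; x∈p∪q⁻)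
open import Function using (flip)
open import Function.Bundles using (_⇔_; _↣_; mk⇔; Equivalence)
open import Function.Construct.Symmetry using (⇔-sym)
open import Function.Related.TypeIsomorphisms using (¬-cong-⇔)

module BisimulationInvariance (k : ℕ) (P : Set) where
  open Logic k P
  open IsBisim
  open Equivalence

  Invariant : {A A' : Set} → (A → A' → Set) → (A → Set) → (A' → Set) → Set
  Invariant Z X X' = ∀ {u u'} → Z u u' → X u ⇔ X' u'

  Forth : (M M' : Model) → (W M → W M' → Set) → Set
  Forth M M' Z = ∀ {u u'} → Z u u' → ∀ G v → RG M G u v →
                 Σ (W M') λ v' → RG M' G u' v' × Z v v'

  RG-antitone : ∀ (M : Model) {G H u v} → G ⊆ H → RG M H u v → RG M G u v
  RG-antitone M G⊆H r i i∈G = r i (G⊆H i∈G)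

  RG-∪ : ∀ (M : Model) {G H u v} → RG M G u v → RG M H u v → RG M (G ∪ H) u v
  RG-∪ M {G} rG rH i i∈G∪H with x∈p∪q⁻ G _ i∈G∪H
  ... | inj₁ i∈G = rG i i∈G
  ... | inj₂ i∈H = rH i i∈H

  module Update (M : Model) (S : Group) (X : W M → Set) where

    -- For non-empty G the disjunct R_S ∪ ∼_χ is chosen uniformly over the agents of G,
    -- so one agent of G decides it for all of them.
    RG-upd-split : ∀ {G u v} → Nonempty G → RG (upd M S X) G u v →
                   RG M (G ∪ S) u v ⊎ (RG M G u v × Sim X u v)
    RG-upd-split (i , i∈G) r with proj₂ (r i i∈G)
    ... | inj₁ rS  = inj₁ (RG-∪ M (λ j j∈G → proj₁ (r j j∈G)) rS)
    ... | inj₂ sim = inj₂ ((λ j j∈G → proj₁ (r j j∈G)) , sim)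

    RG-upd-intro : ∀ {G u v} → RG M (G ∪ S) u v ⊎ (RG M G u v × Sim X u v) →
                   RG (upd M S X) G u v
    RG-upd-intro {G} (inj₁ r) i i∈G =
      r i (p⊆p∪q S i∈G) , inj₁ (RG-antitone M (q⊆p∪q G S) r)
    RG-upd-intro (inj₂ (r , sim)) i i∈G = r i i∈G , inj₂ sim

  Sim-invariant : ∀ {A A'} {Z : A → A' → Set} {X X'} → Invariant Z X X' →
                  ∀ {u u' v v'} → Z u u' → Z v v' → Sim X u v → Sim X' u' v'
  Sim-invariant inv z z' (inj₁ (x , y)) = inj₁ (to (inv z) x , to (inv z') y)
  Sim-invariant inv z z' (inj₂ (¬x , ¬y)) =
    inj₂ ((λ x → ¬x (from (inv z) x)) , (λ y → ¬y (from (inv z') y)))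

  upd-forth : ∀ {M M' Z} S {X X'} → Forth M M' Z → Invariant Z X X' →
              Forth (upd M S X) (upd M' S X') Z
  upd-forth {M} {M'} {Z} S {X} {X'} fw inv z G v r with nonempty? G
  ... | no G-empty =
    let (v' , _ , z') = fw z G v (λ i i∈G → ⊥-elim (G-empty (i , i∈G)))
    in v' , (λ i i∈G → ⊥-elim (G-empty (i , i∈G))) , z'
  ... | yes G-nonempty with Update.RG-upd-split M S X G-nonempty r
  ... | inj₁ rG∪S =
    let (v' , r' , z') = fw z (G ∪ S) v rG∪S
    in v' , Update.RG-upd-intro M' S X' (inj₁ r') , z'
  ... | inj₂ (rG , sim) =
    let (v' , r' , z') = fw z G v rG
        sim' = Sim-invariant {Z = Z} {X} {X'} inv z z' sim
    in v' , Update.RG-upd-intro M' S X' (inj₂ (r' , sim')) , z'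

  upd-bisim : ∀ {M M' Z} S {X X'} → IsBisim M M' Z → Invariant Z X X' →
              IsBisim (upd M S X) (upd M' S X') Z
  upd-bisim {M} {M'} {Z} S {X} {X'} b inv = record
    { nonempty = nonempty b
    ; atoms    = atoms b
    ; forth    = upd-forth {M} {M'} {Z} S (forth b) inv
    ; back     = upd-forth {M'} {M} {flip Z} S {X'} {X} (back b) (λ z → ⇔-sym (inv z))
    }

  Π-⇔ : ∀ {A : Set} {B B' : A → Set} → (∀ a → B a ⇔ B' a) → (∀ a → B a) ⇔ (∀ a → B' a)
  Π-⇔ e = mk⇔ (λ h a → to (e a) (h a)) (λ h a → from (e a) (h a))

  Box : (M : Model) → Group → (W M → Set) → W M → Set
  Box M G X u = ∀ v → RG M G u v → X v

  box-invariant : ∀ {M M' Z X X'} → IsBisim M M' Z → ∀ G → Invariant Z X X' →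
                  Invariant Z (Box M G X) (Box M' G X')
  box-invariant b G inv z = mk⇔
    (λ h v' r' → let (v , r , z') = back b z G v' r' in to (inv z') (h v r))
    (λ h v r → let (v' , r' , z') = forth b z G v r in from (inv z') (h v' r'))

  satD-invariant : ∀ {M M' Z} → IsBisim M M' Z → ∀ φ →
                   Invariant Z (λ u → satD M u φ) (λ u' → satD M' u' φ)
  satD-invariant b (atom p)  z = atoms b z p
  satD-invariant b (neg φ)   z = ¬-cong-⇔ (satD-invariant b φ z)
  satD-invariant b (and φ ψ) z = satD-invariant b φ z ×-⇔ satD-invariant b ψ z
  satD-invariant b (D G _ φ) z = box-invariant b G (satD-invariant b φ) z

  sat-invariant : ∀ {n M M' Z} → IsBisim M M' Z → (φ : Form n) →
                  Invariant Z (λ u → sat M u φ) (λ u' → sat M' u' φ)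
  sat-invariant b (atom p)  z = atoms b z p
  sat-invariant b (neg φ)   z = ¬-cong-⇔ (sat-invariant b φ z)
  sat-invariant b (and φ ψ) z = sat-invariant b φ z ×-⇔ sat-invariant b ψ z
  sat-invariant b (D G _ φ) z = box-invariant b G (sat-invariant b φ) z
  sat-invariant b (all S φ) z =
    Π-⇔ λ χ → sat-invariant (upd-bisim S b (satD-invariant b χ)) φ z
  sat-invariant b (ann _ S χ φ) z = sat-invariant (upd-bisim S b (sat-invariant b χ)) φ z

theorem4p4 : (k : ℕ) (P : Set) → P → (P ↣ ℕ) →
    (M M' : Logic.Model k P) (w : Logic.Model.W M) (w' : Logic.Model.W M') →
    Logic.CollBisimilar k P (M , w) (M' , w') →
    (ψ : Logic.LStar k P) →
    (Logic._⊩_ k P (M , w) ψ ⇔ Logic._⊩_ k P (M' , w') ψ)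
theorem4p4 k P _ _ M M' w w' (Z , bisim , wZw') (_ , ψ) =
  BisimulationInvariance.sat-invariant k P bisim ψ wZw'
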